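{- For every integer $t\ge 2$ and all positive integers $d,k$ there exists an integer $m=m(t,k,d)\le k^{2^{d-1}}+t-1$ with the following property: the $t$-tuples of every finite point set $S\subset\mathbb{R}^d$ can be $k$-colored such that every axis-parallel box that contains at least $m$ points of $S$ contains $t$-tuples of points of each of the $k$ colors.
   Context: An axis-parallel box in $\mathbb{R}^d$ is an intersection of closed halfspaces of the form $\{\mathbf{p}\mid (\mathbf{p})_i\le\beta\}$ or $\{\mathbf{p}\mid(\mathbf{p})_i\ge\beta\}$, where $(\mathbf{p})_i$ is the $i$th coordinate. A $t$-tuple of $S$ is an unordered $t$-element subset of $S$; a region contains a $t$-tuple if it contains all its points. -}

module Defs where

open import Level using (0ℓ)
open import Data.Nat using (ℕ; _≤_)
open import Data.Bool using (Bool; true; false)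
open import Data.Fin using (Fin)
open import Data.Fin.Subset using (Subset; _∈_; ∣_∣)
open import Data.List using (List)
open import Data.List.Relation.Unary.All using (All)
open import Data.Product using (Σ; _×_)
open import Relation.Binary.PropositionalEquality using (_≡_)
open import Relation.Binary.Bundles using (TotalOrder)

-- Geometry over an arbitrary totally ordered coordinate set
-- (ℝ with its usual order is one instance).
module Geometry (O : TotalOrder 0ℓ 0ℓ 0ℓ) (d : ℕ) where
  open TotalOrder O renaming (Carrier to R; _≤_ to _≤R_)

  Point : Set
  Point = Fin d → R

  record Halfspace : Set where
    constructor halfspace
    field
      coord : Fin d
      upper : Bool
      bound : R

  inHalfspace : Halfspace → Point → Set
  inHalfspace (halfspace i true β) p = p i ≤R β
  inHalfspace (halfspace i false β) p = β ≤R p i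

  Box : Set
  Box = List Halfspace

  inBox : Box → Point → Set
  inBox B p = All (λ h → inHalfspace h p) B

  PointSet : ℕ → Set
  PointSet n = Σ (Fin n → Point) λ S →
    (a b : Fin n) → ((i : Fin d) → S a i ≈ S b i) → a ≡ b

  SubsetInBox : {n : ℕ} → (Fin n → Point) → Box → Subset n → Set
  SubsetInBox {n} S B s = (a : Fin n) → a ∈ s → inBox B (S a)

  ContainsAtLeast : {n : ℕ} → (Fin n → Point) → Box → ℕ → Set
  ContainsAtLeast {n} S B m = Σ (Subset n) λ s → (m ≤ ∣ s ∣) × SubsetInBox S B s

  ContainsTupleOfColour : {n k : ℕ} → (Fin n → Point) → ℕ →
    (Subset n → Fin k) → Box → Fin k → Set
  ContainsTupleOfColour {n} S t c B j =
    Σ (Subset n) λ s → (∣ s ∣ ≡ t) × SubsetInBox S B s × (c s ≡ j)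

module Submission where

-- Rank the points in every coordinate, breaking ties arbitrarily.  For points u, x with u left of x, let
-- λ(u, x) be the number of points of a longest chain from u to x in the orthant order that increases in
-- the first coordinate and, in each other coordinate, moves in the direction from u to x.  A tuple gets
-- the colour λ(u, x) − 2 mod k, where u and x are its two leftmost points.  In a box with
-- k^(2^(d−1)) + t − 1 points set the t − 2 rightmost points R aside.  A pigeonhole argument over the
-- capped chain heights of the remaining k^(2^(d−1)) + 1 points in the 2^(d−1) orthant orders
-- (Erdős–Szekeres) yields a chain u, …, b of k + 1 of them in one orthant order, and along a longest chain
-- from u to b the value λ(u, x) runs through 2, …, k + 1.  Every such x lies in the bounding box of u and
-- b, hence in the box, so {u, x} ∪ R provides a t-tuple of each colour.

open import Defs
open import Level using (0ℓ)
open import Function using (_∘_; id)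
open import Data.Bool using (true; false; if_then_else_)
open import Data.Unit using (⊤; tt)
open import Data.Product using (Σ; _×_; _,_; proj₁; proj₂)
import Data.Product as Product
open import Data.Sum using (_⊎_; inj₁; inj₂)
import Data.Sum as Sum
open import Data.Nat using (ℕ; zero; suc; pred; NonZero; >-nonZero; _+_; _∸_; _^_; _⊓_; _≤_; _<_; _<?_; z≤n; s≤s)
open import Data.Nat.Properties
open import Data.Nat.DivMod using (_mod_; m<n⇒m%n≡m)
open import Data.Fin using (Fin; toℕ; fromℕ<)
import Data.Fin as Fin
open import Data.Fin.Base using (finToFun; funToFin)
open import Data.Fin.Properties using (all?; pigeonhole; finToFun-funToFin; toℕ-fromℕ<; toℕ-injective; toℕ<n)
open import Data.Fin.Subset using (Subset; inside; outside; ⁅_⁆; _∪_; ∣_∣)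
  renaming (⊥ to ∅; _∈_ to _∈ₛ_; _∉_ to _∉ₛ_)
open import Data.Fin.Subset.Properties
  using (∣⊥∣≡0; ∉⊥; p⊆q⇒∣p∣≤∣q∣; ∪-identityˡ; x∈⁅x⁆; x∈⁅y⁆⇒x≡y; x∈p∪q⁺; x∈p∪q⁻) renaming (_∈?_ to _∈ₛ?_)
open import Data.Vec.Base using (_∷_; here; there)
open import Data.List using (List; []; _∷_; _++_; length; foldr; map; allFin; lookup; filter; take; drop)
open import Data.List.Properties using (length-take; length-drop; take++drop≡id)
open import Data.List.Extrema.Nat using (max; argmax-sel; xs≤max)
open import Data.List.Relation.Unary.Any using (here; there)
open import Data.List.Relation.Unary.All using (All; []; _∷_)
import Data.List.Relation.Unary.All as All
import Data.List.Relation.Unary.All.Properties as All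
open import Data.List.Relation.Unary.AllPairs using (AllPairs; []; _∷_)
import Data.List.Relation.Unary.AllPairs as AllPairs
import Data.List.Relation.Unary.AllPairs.Properties as AllPairs
open import Data.List.Relation.Unary.Unique.Propositional using (Unique)
open import Data.List.Relation.Unary.Unique.Propositional.Properties using (allFin⁺)
open import Data.List.Membership.Propositional using (_∈_)
open import Data.List.Membership.Propositional.Properties
  using (∈-map⁺; ∈-map⁻; ∈-allFin; ∈-lookup; ∈-++⁺ˡ; ∈-++⁺ʳ; ∈-filter⁺; ∈-filter⁻)
import Data.List.Membership.DecPropositional as DecMembership
open import Data.List.Relation.Binary.Permutation.Propositional
  using (_↭_; ↭-refl; ↭-sym; ↭-trans; ↭-prep; ↭-swap; ↭⇒↭ₛ)
open import Data.List.Relation.Binary.Permutation.Propositional.Properties using (All-resp-↭; ∈-resp-↭)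
open import Data.List.Relation.Binary.Permutation.Setoid.Properties using (Unique-resp-↭)
open import Relation.Nullary using (¬_; Dec; yes; no; does; contradiction)
open import Relation.Nullary.Decidable using (_×-dec_)
open import Relation.Unary using (Decidable)
open import Relation.Binary.Definitions using (DecidableEquality) renaming (Decidable to Decidable₂)
open import Relation.Binary.Bundles using (TotalOrder)
open import Relation.Binary.PropositionalEquality
  using (_≡_; _≢_; _≗_; refl; sym; trans; cong; subst; subst₂; setoid)

module _ {n : ℕ} where

  fromList : List (Fin n) → Subset n
  fromList = foldr (λ x p → ⁅ x ⁆ ∪ p) ∅

  ∈-fromList⁺ : ∀ {x xs} → x ∈ xs → x ∈ₛ fromList xs
  ∈-fromList⁺ (here refl) = x∈p∪q⁺ (inj₁ (x∈⁅x⁆ _))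
  ∈-fromList⁺ (there x∈xs) = x∈p∪q⁺ (inj₂ (∈-fromList⁺ x∈xs))

  ∈-fromList⁻ : ∀ {x} xs → x ∈ₛ fromList xs → x ∈ xs
  ∈-fromList⁻ [] x∈∅ = contradiction x∈∅ ∉⊥
  ∈-fromList⁻ (y ∷ ys) x∈ with x∈p∪q⁻ ⁅ y ⁆ (fromList ys) x∈
  ... | inj₁ x∈⁅y⁆ = here (x∈⁅y⁆⇒x≡y y x∈⁅y⁆)
  ... | inj₂ x∈ys = there (∈-fromList⁻ ys x∈ys)

∣⁅x⁆∪p∣≡1+∣p∣ : ∀ {n} (x : Fin n) (p : Subset n) → x ∉ₛ p → ∣ ⁅ x ⁆ ∪ p ∣ ≡ suc ∣ p ∣
∣⁅x⁆∪p∣≡1+∣p∣ Fin.zero (inside ∷ p) x∉p = contradiction here x∉p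
∣⁅x⁆∪p∣≡1+∣p∣ Fin.zero (outside ∷ p) x∉p = cong (suc ∘ ∣_∣) (∪-identityˡ p)
∣⁅x⁆∪p∣≡1+∣p∣ (Fin.suc x) (inside ∷ p) x∉p = cong suc (∣⁅x⁆∪p∣≡1+∣p∣ x p (x∉p ∘ there))
∣⁅x⁆∪p∣≡1+∣p∣ (Fin.suc x) (outside ∷ p) x∉p = ∣⁅x⁆∪p∣≡1+∣p∣ x p (x∉p ∘ there)

∣fromList∣≡length : ∀ {n} {xs : List (Fin n)} → Unique xs → ∣ fromList xs ∣ ≡ length xs
∣fromList∣≡length {n} {xs = []} [] = ∣⊥∣≡0 n
∣fromList∣≡length {xs = x ∷ xs} (x∉xs ∷ !xs) = trans
  (∣⁅x⁆∪p∣≡1+∣p∣ x (fromList xs) (λ x∈ → All.lookup x∉xs (∈-fromList⁻ xs x∈) refl))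
  (cong suc (∣fromList∣≡length !xs))

AllPairs-++⁻ : ∀ {A : Set} {R : A → A → Set} xs {ys} → AllPairs R (xs ++ ys) →
  AllPairs R xs × AllPairs R ys × (∀ {x y} → x ∈ xs → y ∈ ys → R x y)
AllPairs-++⁻ [] rs = [] , rs , λ ()
AllPairs-++⁻ (x ∷ xs) (r ∷ rs) with AllPairs-++⁻ xs rs
... | xs↑ , ys↑ , across = All.++⁻ˡ xs r ∷ xs↑ , ys↑ ,
  λ { (here refl) y∈ys → All.lookup (All.++⁻ʳ xs r) y∈ys ; (there x∈xs) y∈ys → across x∈xs y∈ys }

splitFromEnd : ∀ {A : Set} t (xs : List A) → t ≤ length xs → Σ (List A) λ ys → Σ (List A) λ zs →
  ys ++ zs ≡ xs × length ys ≡ length xs ∸ t × length zs ≡ t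
splitFromEnd t xs t≤∣xs∣ =
  take c xs , drop c xs , take++drop≡id c xs ,
  trans (length-take c xs) (m≤n⇒m⊓n≡m (m∸n≤m (length xs) t)) ,
  trans (length-drop c xs) (m∸[m∸n]≡n t≤∣xs∣)
  where
  c : ℕ
  c = length xs ∸ t

AllPairs-lookup : ∀ {A : Set} {R : A → A → Set} {xs} → AllPairs R xs →
  ∀ {i j} → i Fin.< j → R (lookup xs i) (lookup xs j)
AllPairs-lookup (r ∷ _) {Fin.zero} {Fin.suc j} _ = All.lookup r (∈-lookup j)
AllPairs-lookup (_ ∷ rs) {Fin.suc i} {Fin.suc j} i<j = AllPairs-lookup rs (≤-pred i<j)

module _ {A : Set} (key : A → ℕ) where

  Increasing : List A → Set
  Increasing = AllPairs (λ a c → key a < key c)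

  Increasing⇒Unique : ∀ {xs} → Increasing xs → Unique xs
  Increasing⇒Unique = AllPairs.map λ a<c a≡c → <-irrefl (cong key a≡c) a<c

  tail-⊆ : ∀ {x us vs} → All (λ c → key x < key c) us →
    (∀ {z} → z ∈ x ∷ us → z ∈ x ∷ vs) → ∀ {z} → z ∈ us → z ∈ vs
  tail-⊆ x<us us⊆vs z∈us with us⊆vs (there z∈us)
  ... | here refl = contradiction (All.lookup x<us z∈us) (<-irrefl refl)
  ... | there z∈vs = z∈vs

  Increasing-≡ : ∀ {xs ys} → Increasing xs → Increasing ys → (∀ {z} → z ∈ xs → z ∈ ys) →
    (∀ {z} → z ∈ ys → z ∈ xs) → xs ≡ ys
  Increasing-≡ {[]} {[]} _ _ _ _ = refl
  Increasing-≡ {[]} {y ∷ _} _ _ _ ys⊆xs = contradiction (ys⊆xs (here refl)) λ ()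
  Increasing-≡ {x ∷ _} {[]} _ _ xs⊆ys _ = contradiction (xs⊆ys (here refl)) λ ()
  Increasing-≡ {x ∷ xs} {y ∷ ys} (x<xs ∷ xs↑) (y<ys ∷ ys↑) xs⊆ys ys⊆xs with xs⊆ys (here refl) | ys⊆xs (here refl)
  ... | here refl | _ = cong (x ∷_) (Increasing-≡ xs↑ ys↑ (tail-⊆ x<xs xs⊆ys) (tail-⊆ y<ys ys⊆xs))
  ... | there x∈ys | here refl = contradiction (All.lookup y<ys x∈ys) (<-irrefl refl)
  ... | there x∈ys | there y∈xs = contradiction (All.lookup x<xs y∈xs) (<⇒≯ (All.lookup y<ys x∈ys))

module InsertionSort {A : Set} {_≤_ : A → A → Set}
  (total : ∀ x y → x ≤ y ⊎ y ≤ x) (≤-trans : ∀ {x y z} → x ≤ y → y ≤ z → x ≤ z) where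

  insert : A → List A → List A
  insert x [] = x ∷ []
  insert x (y ∷ ys) with total x y
  ... | inj₁ _ = x ∷ y ∷ ys
  ... | inj₂ _ = y ∷ insert x ys

  sort : List A → List A
  sort = foldr insert []

  insert-↭ : ∀ x ys → insert x ys ↭ x ∷ ys
  insert-↭ x [] = ↭-refl
  insert-↭ x (y ∷ ys) with total x y
  ... | inj₁ _ = ↭-refl
  ... | inj₂ _ = ↭-trans (↭-prep y (insert-↭ x ys)) (↭-swap y x ↭-refl)

  sort-↭ : ∀ xs → sort xs ↭ xs
  sort-↭ [] = ↭-refl
  sort-↭ (x ∷ xs) = ↭-trans (insert-↭ x (sort xs)) (↭-prep x (sort-↭ xs))

  insert-sorted : ∀ x {ys} → AllPairs _≤_ ys → AllPairs _≤_ (insert x ys)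
  insert-sorted x [] = [] ∷ []
  insert-sorted x {y ∷ ys} (y≤ys ∷ ys↑) with total x y
  ... | inj₁ x≤y = (x≤y ∷ All.map (≤-trans x≤y) y≤ys) ∷ y≤ys ∷ ys↑
  ... | inj₂ y≤x = All-resp-↭ (↭-sym (insert-↭ x ys)) (y≤x ∷ y≤ys) ∷ insert-sorted x ys↑

  sort-sorted : ∀ xs → AllPairs _≤_ (sort xs)
  sort-sorted [] = []
  sort-sorted (x ∷ xs) = insert-sorted x (sort-sorted xs)

module Position {A : Set} (_≟_ : DecidableEquality A) where

  position : List A → A → ℕ
  position [] x = 0
  position (y ∷ ys) x with x ≟ y
  ... | yes _ = 0
  ... | no _ = suc (position ys x)

  position-here : ∀ y ys → position (y ∷ ys) y ≡ 0
  position-here y ys with y ≟ y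
  ... | yes _ = refl
  ... | no y≢y = contradiction refl y≢y

  position-there : ∀ {y z} ys → y ≢ z → position (y ∷ ys) z ≡ suc (position ys z)
  position-there {y} {z} ys y≢z with z ≟ y
  ... | yes z≡y = contradiction (sym z≡y) y≢z
  ... | no _ = refl

  position-< : ∀ {x} xs → x ∈ xs → position xs x < length xs
  position-< {x} (y ∷ ys) x∈ with x ≟ y | x∈
  ... | yes _ | _ = s≤s z≤n
  ... | no x≢y | here x≡y = contradiction x≡y x≢y
  ... | no _ | there x∈ys = s≤s (position-< ys x∈ys)

  position-injective : ∀ {x z} xs → x ∈ xs → z ∈ xs → position xs x ≡ position xs z → x ≡ z
  position-injective {x} {z} (y ∷ ys) x∈ z∈ eq with x ≟ y | z ≟ y | x∈ | z∈
  ... | yes refl | yes refl | _ | _ = refl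
  ... | no x≢y | _ | here x≡y | _ = contradiction x≡y x≢y
  ... | _ | no z≢y | _ | here z≡y = contradiction z≡y z≢y
  ... | no _ | no _ | there x∈ys | there z∈ys = position-injective ys x∈ys z∈ys (suc-injective eq)

  position-increasing : ∀ {xs} → Unique xs → Increasing (position xs) xs
  position-increasing {[]} [] = []
  position-increasing {y ∷ ys} (y∉ys ∷ !ys) =
    All.map first< y∉ys ∷ shift y∉ys (position-increasing !ys)
    where
    first< : ∀ {z} → y ≢ z → position (y ∷ ys) y < position (y ∷ ys) z
    first< y≢z rewrite position-here y ys | position-there ys y≢z = s≤s z≤n

    shift : ∀ {zs} → All (y ≢_) zs → Increasing (position ys) zs → Increasing (position (y ∷ ys)) zs
    shift [] [] = []
    shift (y≢z ∷ y≢zs) (z<zs ∷ zs↑) =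
      All.zipWith (λ (y≢c , z<c) → subst₂ _<_ (sym (position-there ys y≢z)) (sym (position-there ys y≢c)) (s≤s z<c))
        (y≢zs , z<zs) ∷ shift y≢zs zs↑

  position-<⇒related : ∀ {R : A → A → Set} {xs a c} → AllPairs R xs → a ∈ xs → c ∈ xs →
    position xs a < position xs c → R a c
  position-<⇒related {xs = y ∷ ys} {a} {c} (y≤ys ∷ ys↑) a∈ c∈ a<c with a ≟ y | c ≟ y | a∈ | c∈
  ... | _ | yes refl | _ | _ = contradiction a<c λ ()
  ... | _ | no c≢y | _ | here c≡y = contradiction c≡y c≢y
  ... | yes refl | no _ | _ | there c∈ys = All.lookup y≤ys c∈ys
  ... | no a≢y | no _ | here a≡y | there _ = contradiction a≡y a≢y
  ... | no _ | no _ | there a∈ys | there c∈ys = position-<⇒related ys↑ a∈ys c∈ys (≤-pred a<c)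

data Chain {A : Set} (P : A → Set) (R : A → A → Set) : A → A → ℕ → Set where
  [_] : ∀ {a} → P a → Chain P R a a 1
  step : ∀ {a b c m} → P a → R a b → Chain P R b c m → Chain P R a c (suc m)

module _ {A : Set} {P : A → Set} {R : A → A → Set} where

  chain-head : ∀ {a b m} → Chain P R a b m → P a
  chain-head [ pa ] = pa
  chain-head (step pa _ _) = pa

  chain-last : ∀ {a b m} → Chain P R a b m → P b
  chain-last [ pb ] = pb
  chain-last (step _ _ ch) = chain-last ch

  chain-length-pos : ∀ {a b m} → Chain P R a b m → 0 < m
  chain-length-pos [ _ ] = s≤s z≤n
  chain-length-pos (step _ _ _) = s≤s z≤n

  -- the two chains share their common node b
  _++ᶜ_ : ∀ {a b c m m′} → Chain P R a b (suc m) → Chain P R b c m′ → Chain P R a c (m + m′)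
  [ _ ] ++ᶜ ch′ = ch′
  _++ᶜ_ {m = suc m} (step pa r ch) ch′ = step pa r (ch ++ᶜ ch′)

  splitAt : ∀ {a b} m j → j < m → Chain P R a b m →
    Σ A λ x → Chain P R a x (suc j) × Chain P R x b (m ∸ j)
  splitAt (suc m) zero _ ch = _ , [ chain-head ch ] , ch
  splitAt (suc m) (suc j) (s≤s (s≤s j<m)) (step pa r ch) with splitAt m j (s≤s j<m) ch
  ... | x , ch₁ , ch₂ = x , step pa r ch₁ , ch₂

  snoc : ∀ {a b c m} → Chain P R a b m → R b c → P c → Chain P R a c (suc m)
  snoc [ pa ] r pc = step pa r [ pc ]
  snoc (step pa r ch) r′ pc = step pa r (snoc ch r′ pc)

  unsnoc : ∀ {a b m} → Chain P R a b (suc (suc m)) → Σ A λ x → Chain P R a x (suc m) × R x b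
  unsnoc (step pa r [ _ ]) = _ , [ pa ] , r
  unsnoc {m = suc m} (step pa r ch@(step _ _ _)) with unsnoc ch
  ... | x , ch′ , rx = x , step pa r ch′ , rx

mapᶜ : ∀ {A : Set} {P P′ : A → Set} {R R′ : A → A → Set} →
  (∀ {x} → P x → P′ x) → (∀ {x y} → R x y → R′ x y) →
  ∀ {a b m} → Chain P R a b m → Chain P′ R′ a b m
mapᶜ f g [ pa ] = [ f pa ]
mapᶜ f g (step pa r ch) = step (f pa) (g r) (mapᶜ f g ch)

module _ {A : Set} {R : A → A → Set} (R-trans : ∀ {x y z} → R x y → R y z → R x z) where

  chain-reaches : ∀ {P a b m} → Chain {A} P R a b m → a ≡ b ⊎ R a b
  chain-reaches [ _ ] = inj₁ refl
  chain-reaches (step _ r ch) with chain-reaches ch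
  ... | inj₁ refl = inj₂ r
  ... | inj₂ r′ = inj₂ (R-trans r r′)

  chain-related : ∀ {P a b m} → Chain P R a b (suc (suc m)) → R a b
  chain-related (step _ r ch) with chain-reaches ch
  ... | inj₁ refl = r
  ... | inj₂ r′ = R-trans r r′

  chain-below : ∀ {P a b c m} → R b c → Chain P R a b m → Chain (λ x → P x × R x c) R a b m
  chain-below r [ pb ] = [ pb , r ]
  chain-below r (step pa r′ ch) with chain-below r ch
  ... | ch′ = step (pa , R-trans r′ (proj₂ (chain-head ch′))) r′ ch′

module LongestChain {n : ℕ} {P : Fin n → Set} {R : Fin n → Fin n → Set}
  (P? : Decidable P) (R? : Decidable₂ R) where

  -- longest chain starting at c, among chains of at most f nodes
  mutual
    height : ℕ → Fin n → ℕ
    height zero c = 0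
    height (suc f) c = if does (P? c) then suc (max 0 (map (heightAfter f c) (allFin n))) else 0

    heightAfter : ℕ → Fin n → Fin n → ℕ
    heightAfter f c e = if does (R? c e) then height f e else 0

  height-complete : ∀ f {c e m} → Chain P R c e m → m ≤ f → m ≤ height f c
  height-complete zero ch m≤0 = contradiction (≤-trans (chain-length-pos ch) m≤0) λ ()
  height-complete (suc f) {c} ch m≤f with P? c
  ... | no ¬pc = contradiction (chain-head ch) ¬pc
  ... | yes _ with ch
  ...   | [ _ ] = s≤s z≤n
  ...   | step {b = b} _ r ch′ = s≤s (≤-trans (after (R? c b)) (All.lookup (xs≤max 0 _) (∈-map⁺ _ (∈-allFin b))))
    where
    after : (r? : Dec (R c b)) → _ ≤ (if does r? then height f b else 0)
    after (yes _) = height-complete f ch′ (≤-pred m≤f)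
    after (no ¬r) = contradiction r ¬r

  mutual
    height-sound : ∀ f c → 0 < height f c → Σ (Fin n) λ e → Chain P R c e (height f c)
    height-sound (suc f) c pos with P? c
    ... | no _ = contradiction pos λ ()
    ... | yes pc with argmax-sel id 0 (map (heightAfter f c) (allFin n))
    ...   | inj₁ max≡0 = subst (λ v → Σ (Fin n) λ e → Chain P R c e (suc v)) (sym max≡0) (c , [ pc ])
    ...   | inj₂ max∈ with ∈-map⁻ (heightAfter f c) max∈
    ...     | e , _ , max≡ = subst (λ v → Σ (Fin n) λ e → Chain P R c e (suc v)) (sym max≡) (extend {f} pc e)

    extend : ∀ {f c} → P c → ∀ e → Σ (Fin n) λ e′ → Chain P R c e′ (suc (heightAfter f c e))
    extend {f} {c} pc e with R? c e
    ... | no _ = c , [ pc ]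
    ... | yes r = prepend (height f e) refl
      where
      prepend : ∀ v → height f e ≡ v → Σ (Fin n) λ e′ → Chain P R c e′ (suc v)
      prepend zero _ = c , [ pc ]
      prepend (suc v) eq with height-sound f e (subst (0 <_) (sym eq) (s≤s z≤n))
      ... | e′ , ch = e′ , step pc r (subst (Chain P R e e′) eq ch)

clamp : ∀ k → ℕ → Fin (suc k)
clamp k v = fromℕ< (s≤s (m⊓n≤n v k))

clamp-collision : ∀ k {x y} → x < y → clamp k x ≡ clamp k y → k ≤ x
clamp-collision k {x} {y} x<y same = ≮⇒≥ x≮k
  where
  x⊓k≡y⊓k : x ⊓ k ≡ y ⊓ k
  x⊓k≡y⊓k = trans (sym (toℕ-fromℕ< _)) (trans (cong toℕ same) (toℕ-fromℕ< _))
  x≮k : ¬ x < k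
  x≮k x<k with ⊓-sel y k
  ... | inj₁ y⊓k≡y = <-irrefl (trans (sym (m≤n⇒m⊓n≡m (<⇒≤ x<k))) (trans x⊓k≡y⊓k y⊓k≡y)) x<y
  ... | inj₂ y⊓k≡k = <-irrefl (trans (sym (m≤n⇒m⊓n≡m (<⇒≤ x<k))) (trans x⊓k≡y⊓k y⊓k≡k)) x<k

Signature : ℕ → Set
Signature d = Fin d → Fin 2

Oriented : Fin 2 → ℕ → ℕ → Set
Oriented Fin.zero x y = x < y
Oriented (Fin.suc _) x y = y < x

Oriented? : ∀ s x y → Dec (Oriented s x y)
Oriented? Fin.zero x y = x <? y
Oriented? (Fin.suc _) x y = y <? x

Oriented-trans : ∀ s {x y z} → Oriented s x y → Oriented s y z → Oriented s x z
Oriented-trans Fin.zero x<y y<z = <-trans x<y y<z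
Oriented-trans (Fin.suc _) y<x z<y = <-trans z<y y<x

orientation : ℕ → ℕ → Fin 2
orientation x y with x <? y
... | yes _ = Fin.zero
... | no _ = Fin.suc Fin.zero

orientation-oriented : ∀ {x y} → x ≢ y → Oriented (orientation x y) x y
orientation-oriented {x} {y} x≢y with x <? y
... | yes x<y = x<y
... | no x≮y = ≤∧≢⇒< (≮⇒≥ x≮y) (x≢y ∘ sym)

Oriented⇒orientation : ∀ s {x y} → Oriented s x y → orientation x y ≡ s
Oriented⇒orientation Fin.zero {x} {y} x<y with x <? y
... | yes _ = refl
... | no x≮y = contradiction x<y x≮y
Oriented⇒orientation (Fin.suc Fin.zero) {x} {y} y<x with x <? y
... | yes x<y = contradiction x<y (<⇒≯ y<x)
... | no _ = refl

Between : ∀ {A : Set} → (A → A → Set) → A → A → A → Set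
Between _≤_ x y z = (x ≤ y × y ≤ z) ⊎ (z ≤ y × y ≤ x)

Oriented⇒Between : ∀ s {x y z} → Oriented s x y → y ≡ z ⊎ Oriented s y z → Between _≤_ x y z
Oriented⇒Between Fin.zero x<y (inj₁ refl) = inj₁ (<⇒≤ x<y , ≤-refl)
Oriented⇒Between Fin.zero x<y (inj₂ y<z) = inj₁ (<⇒≤ x<y , <⇒≤ y<z)
Oriented⇒Between (Fin.suc _) y<x (inj₁ refl) = inj₂ (≤-refl , <⇒≤ y<x)
Oriented⇒Between (Fin.suc _) y<x (inj₂ z<y) = inj₂ (<⇒≤ z<y , <⇒≤ y<x)

module Ranked {n d : ℕ} (rank : Fin (suc d) → Fin n → ℕ)
  (rank-injective : ∀ i {a c} → rank i a ≡ rank i c → a ≡ c)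
  (N : ℕ) (rank₀<N : ∀ a → rank Fin.zero a < N) where

  rank₀ : Fin n → ℕ
  rank₀ = rank Fin.zero

  _≺[_]_ : Fin n → Signature d → Fin n → Set
  a ≺[ σ ] c = rank₀ a < rank₀ c × (∀ i → Oriented (σ i) (rank (Fin.suc i) a) (rank (Fin.suc i) c))

  _≼[_]_ : Fin n → Signature d → Fin n → Set
  a ≼[ σ ] c = a ≡ c ⊎ a ≺[ σ ] c

  ≺? : ∀ σ → Decidable₂ (_≺[ σ ]_)
  ≺? σ a c = (rank₀ a <? rank₀ c) ×-dec all? (λ i → Oriented? (σ i) _ _)

  ≺-trans : ∀ σ {a b c} → a ≺[ σ ] b → b ≺[ σ ] c → a ≺[ σ ] c
  ≺-trans σ (a<b , ab) (b<c , bc) = <-trans a<b b<c , λ i → Oriented-trans (σ i) (ab i) (bc i)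

  ≺-resp-≗ : ∀ {σ σ′} → σ ≗ σ′ → ∀ {a c} → a ≺[ σ ] c → a ≺[ σ′ ] c
  ≺-resp-≗ σ≗σ′ (a<c , ac) = a<c , λ i → subst (λ s → Oriented s _ _) (σ≗σ′ i) (ac i)

  signature : Fin n → Fin n → Signature d
  signature a c i = orientation (rank (Fin.suc i) a) (rank (Fin.suc i) c)

  ≺-signature : ∀ {a c} → rank₀ a < rank₀ c → a ≺[ signature a c ] c
  ≺-signature a<c = a<c , λ i → orientation-oriented λ eq →
    <-irrefl (cong rank₀ (rank-injective (Fin.suc i) eq)) a<c

  signature-unique : ∀ {σ a c} → a ≺[ σ ] c → signature a c ≗ σ
  signature-unique {σ} (_ , ac) i = Oriented⇒orientation (σ i) (ac i)

  RankBetween : Fin n → Fin n → Fin n → Set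
  RankBetween a y b = ∀ i → Between _≤_ (rank i a) (rank i y) (rank i b)

  ≼⇒rank₀≤ : ∀ {σ x b} → x ≼[ σ ] b → rank₀ x ≤ rank₀ b
  ≼⇒rank₀≤ (inj₁ refl) = ≤-refl
  ≼⇒rank₀≤ (inj₂ (x<b , _)) = <⇒≤ x<b

  RankBetween-self : ∀ y → RankBetween y y y
  RankBetween-self y i = inj₁ (≤-refl , ≤-refl)

  ≺-between : ∀ {σ a x b} → a ≺[ σ ] x → x ≼[ σ ] b → RankBetween a x b
  ≺-between (a<x , _) x≼b Fin.zero =
    Oriented⇒Between Fin.zero a<x (Sum.map (cong rank₀) proj₁ x≼b)
  ≺-between {σ} (_ , ax) x≼b (Fin.suc i) =
    Oriented⇒Between (σ i) (ax i) (Sum.map (cong (rank (Fin.suc i))) (λ x≺b → proj₂ x≺b i) x≼b)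

  chain-rank-bound : ∀ {P σ a b m} → Chain P (_≺[ σ ]_) a b m → rank₀ a + m ≤ N
  chain-rank-bound {a = a} [ _ ] = subst (_≤ N) (+-comm 1 (rank₀ a)) (rank₀<N a)
  chain-rank-bound {a = a} (step {b = b} {m = m} _ (a<b , _) ch) = begin
    rank₀ a + suc m ≡⟨ +-suc (rank₀ a) m ⟩
    suc (rank₀ a) + m ≤⟨ +-monoˡ-≤ m a<b ⟩
    rank₀ b + m ≤⟨ chain-rank-bound ch ⟩
    N ∎
    where open ≤-Reasoning

  chain-length≤N : ∀ {P σ a b m} → Chain P (_≺[ σ ]_) a b m → m ≤ N
  chain-length≤N {a = a} ch = ≤-trans (m≤n+m _ (rank₀ a)) (chain-rank-bound ch)

  module Towards (a b : Fin n) = LongestChain (λ x → ≺? (signature a b) x b) (≺? (signature a b))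

  -- the number of nodes of a longest chain from a to b in the orthant order selected by a and b
  longest : Fin n → Fin n → ℕ
  longest a b = suc (Towards.height a b N a)

  longest-complete : ∀ {P σ a b m} → Chain P (_≺[ σ ]_) a b m → m ≤ longest a b
  longest-complete {m = suc zero} _ = s≤s z≤n
  longest-complete {σ = σ} {a} {b} {suc (suc m)} ch with unsnoc ch
  ... | x , ch′ , x≺b = s≤s (Towards.height-complete a b N ch″ (chain-length≤N ch″))
    where
    σ≗ : σ ≗ signature a b
    σ≗ = sym ∘ signature-unique (chain-related (≺-trans σ) ch)
    ch″ : Chain (λ x → x ≺[ signature a b ] b) (_≺[ signature a b ]_) a x (suc m)
    ch″ = mapᶜ (≺-resp-≗ σ≗ ∘ proj₂) (≺-resp-≗ σ≗) (chain-below (≺-trans σ) x≺b ch′)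

  longest-sound : ∀ {a b} → rank₀ a < rank₀ b → Chain (λ _ → ⊤) (_≺[ signature a b ]_) a b (longest a b)
  longest-sound {a} {b} a<b with Towards.height-sound a b N a
    (Towards.height-complete a b N [ ≺-signature a<b ] (≤-trans (s≤s z≤n) (rank₀<N a)))
  ... | _ , ch = snoc (mapᶜ _ id ch) (chain-last ch) tt

  longest-intermediate : ∀ {a b} → Chain (λ _ → ⊤) (_≺[ signature a b ]_) a b (longest a b) →
    ∀ j → suc j < longest a b → Σ (Fin n) λ x →
      longest a x ≡ suc (suc j) × a ≺[ signature a b ] x × x ≼[ signature a b ] b
  longest-intermediate {a} {b} ch j j+1<L with splitAt (longest a b) (suc j) j+1<L ch
  ... | x , ch₁ , ch₂ =
    x , ≤-antisym upper (longest-complete ch₁) , a≺x , chain-reaches (≺-trans σ) ch₂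
    where
    σ : Signature d
    σ = signature a b
    a≺x : a ≺[ σ ] x
    a≺x = chain-related (≺-trans σ) ch₁
    ch₀ : Chain (λ _ → ⊤) (_≺[ σ ]_) a x (longest a x)
    ch₀ = mapᶜ id (≺-resp-≗ (signature-unique a≺x)) (longest-sound (proj₁ a≺x))
    -- a longest chain from a to x followed by the rest of ch is again a chain from a to b
    detour : Towards.height a x N a + (longest a b ∸ suc j) ≤ suc j + (longest a b ∸ suc j)
    detour = subst (Towards.height a x N a + (longest a b ∸ suc j) ≤_) (sym (m+[n∸m]≡n (<⇒≤ j+1<L)))
      (longest-complete (ch₀ ++ᶜ ch₂))
    upper : longest a x ≤ suc (suc j)
    upper = s≤s (+-cancelʳ-≤ _ _ _ detour)

  module ErdősSzekeres (k : ℕ) {A : List (Fin n)} (A↑ : Increasing rank₀ A)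
    (A-large : suc k ^ 2 ^ d < length A) where

    open DecMembership (Fin._≟_ {n}) using (_∈?_)
    module InA σ = LongestChain (_∈? A) (≺? σ)

    heightIn : Signature d → Fin n → ℕ
    heightIn σ = InA.height σ N

    heightIn-complete : ∀ {σ p e m} → Chain (_∈ A) (_≺[ σ ]_) p e m → m ≤ heightIn σ p
    heightIn-complete {σ} ch = InA.height-complete σ N ch (chain-length≤N ch)

    heightIn-pos : ∀ σ {p} → p ∈ A → 0 < heightIn σ p
    heightIn-pos σ p∈A = heightIn-complete {σ} [ p∈A ]

    chain-of-height : ∀ σ {p} → p ∈ A → Σ (Fin n) λ e → Chain (_∈ A) (_≺[ σ ]_) p e (heightIn σ p)
    chain-of-height σ {p} p∈A = InA.height-sound σ N p (heightIn-pos σ p∈A)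

    profile : Fin n → Fin (2 ^ d) → Fin (suc k)
    profile p c = clamp k (pred (heightIn (finToFun c) p))

    -- in the orthant order of u towards v the height of u exceeds that of v, so equal capped
    -- heights force the height of u beyond k + 1
    long-chain-from-equal-profiles : ∀ {u v} → u ∈ A → v ∈ A → rank₀ u < rank₀ v → profile u ≗ profile v →
      Σ (Fin n) λ b → Σ (Signature d) λ σ → Chain (_∈ A) (_≺[ σ ]_) u b (suc (suc k))
    long-chain-from-equal-profiles {u} {v} u∈A v∈A u<v same =
      let b , ch , _ = splitAt _ (suc k) k+1<hᵤ (proj₂ (chain-of-height σ u∈A)) in b , σ , ch
      where
      σ : Signature d
      σ = finToFun (funToFin (signature u v))
      u≺v : u ≺[ σ ] v
      u≺v = ≺-resp-≗ (sym ∘ finToFun-funToFin (signature u v)) (≺-signature u<v)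
      instance
        hᵥ≢0 : NonZero (heightIn σ v)
        hᵥ≢0 = >-nonZero (heightIn-pos σ v∈A)
      hᵥ<hᵤ : heightIn σ v < heightIn σ u
      hᵥ<hᵤ = heightIn-complete (step u∈A u≺v (proj₂ (chain-of-height σ v∈A)))
      k<hᵥ : k < heightIn σ v
      k<hᵥ = ≤-trans (s≤s (clamp-collision k (pred-mono-< hᵥ<hᵤ) (sym (same (funToFin (signature u v))))))
        (≤-reflexive (suc-pred _))
      k+1<hᵤ : suc k < heightIn σ u
      k+1<hᵤ = <-≤-trans (s≤s k<hᵥ) hᵥ<hᵤ

    long-chain : Σ (Fin n) λ u → Σ (Fin n) λ b → Σ (Signature d) λ σ → Chain (_∈ A) (_≺[ σ ]_) u b (suc (suc k))
    long-chain with pigeonhole A-large (funToFin ∘ profile ∘ lookup A)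
    ... | i , j , i<j , same-code = lookup A i , long-chain-from-equal-profiles (∈-lookup i) (∈-lookup j)
      (AllPairs-lookup A↑ i<j)
      (λ c → trans (sym (finToFun-funToFin _ c)) (trans (cong (λ z → finToFun z c) same-code) (finToFun-funToFin _ c)))

  module Colouring (order : List (Fin n)) (order-complete : ∀ a → a ∈ order)
    (order↑ : Increasing rank₀ order) (k t : ℕ) where

    colourOf : List (Fin n) → Fin (suc k)
    colourOf (x ∷ y ∷ _) = (longest x y ∸ 2) mod suc k
    colourOf _ = Fin.zero

    colour : Subset n → Fin (suc k)
    colour T = colourOf (filter (_∈ₛ? T) order)

    colour-fromList : ∀ {xs} → Increasing rank₀ xs → colour (fromList xs) ≡ colourOf xs
    colour-fromList {xs} xs↑ = cong colourOf (Increasing-≡ rank₀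
      (AllPairs.filter⁺ (_∈ₛ? fromList xs) order↑) xs↑
      (λ z∈ → ∈-fromList⁻ xs (proj₂ (∈-filter⁻ (_∈ₛ? fromList xs) {xs = order} z∈)))
      (λ z∈xs → ∈-filter⁺ (_∈ₛ? fromList xs) (order-complete _) (∈-fromList⁺ z∈xs)))

    colourOf-longest : ∀ {u x} xs (c : Fin (suc k)) → longest u x ≡ suc (suc (toℕ c)) → colourOf (u ∷ x ∷ xs) ≡ c
    colourOf-longest xs c eq = trans (cong (λ l → (l ∸ 2) mod suc k) eq)
      (toℕ-injective (trans (toℕ-fromℕ< _) (m<n⇒m%n≡m (toℕ<n c))))

    K : ℕ
    K = suc k ^ 2 ^ d

    record PointOfColour (A : List (Fin n)) (c : Fin (suc k)) : Set where
      field
        {u b x} : Fin n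
        σ : Signature d
        u∈A : u ∈ A
        b∈A : b ∈ A
        u≺x : u ≺[ σ ] x
        x≼b : x ≼[ σ ] b
        longest-ux : longest u x ≡ suc (suc (toℕ c))

    point-of-colour : ∀ {A} → Increasing rank₀ A → K < length A → (c : Fin (suc k)) → PointOfColour A c
    point-of-colour A↑ A-large c =
      let u , b , σ , ch = ErdősSzekeres.long-chain k A↑ A-large
          x , longest-ux , u≺x , x≼b = longest-intermediate (longest-sound (proj₁ (chain-related (≺-trans σ) ch)))
            (toℕ c) (≤-trans (s≤s (toℕ<n c)) (longest-complete ch))
      in record { σ = signature u b ; u∈A = chain-head ch ; b∈A = chain-last ch
                ; u≺x = u≺x ; x≼b = x≼b ; longest-ux = longest-ux }

    TupleOfColour : Subset n → Fin (suc k) → Set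
    TupleOfColour s c = Σ (Subset n) λ T → ∣ T ∣ ≡ suc (suc t) ×
      (∀ y → y ∈ₛ T → Σ (Fin n) λ a → Σ (Fin n) λ b → a ∈ₛ s × b ∈ₛ s × RankBetween a y b) × colour T ≡ c

    tuple-from-point : ∀ {s c A R} → PointOfColour A c → (∀ {a r} → a ∈ A → r ∈ R → rank₀ a < rank₀ r) →
      Increasing rank₀ R → length R ≡ t → (∀ {y} → y ∈ A ++ R → y ∈ₛ s) → TupleOfColour s c
    tuple-from-point {s} {c} {A} {R} w A<R R↑ ∣R∣≡t A++R⊆s =
      fromList (u ∷ x ∷ R) , size , members , trans (colour-fromList L↑) (colourOf-longest R c longest-ux)
      where
      open PointOfColour w
      x<R : All (λ r → rank₀ x < rank₀ r) R
      x<R = All.tabulate (≤-<-trans (≼⇒rank₀≤ x≼b) ∘ A<R b∈A)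
      L↑ : Increasing rank₀ (u ∷ x ∷ R)
      L↑ = (proj₁ u≺x ∷ All.map (<-trans (proj₁ u≺x)) x<R) ∷ x<R ∷ R↑
      size : ∣ fromList (u ∷ x ∷ R) ∣ ≡ suc (suc t)
      size = trans (∣fromList∣≡length (Increasing⇒Unique rank₀ L↑)) (cong (suc ∘ suc) ∣R∣≡t)
      u∈s : u ∈ₛ s
      u∈s = A++R⊆s (∈-++⁺ˡ u∈A)
      members : ∀ y → y ∈ₛ fromList (u ∷ x ∷ R) →
        Σ (Fin n) λ a → Σ (Fin n) λ b → a ∈ₛ s × b ∈ₛ s × RankBetween a y b
      members y y∈ with ∈-fromList⁻ (u ∷ x ∷ R) y∈
      ... | here refl = u , u , u∈s , u∈s , RankBetween-self u
      ... | there (here refl) = u , b , u∈s , A++R⊆s (∈-++⁺ˡ b∈A) , ≺-between u≺x x≼b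
      ... | there (there y∈R) = y , y , y∈s , y∈s , RankBetween-self y
        where
        y∈s : y ∈ₛ s
        y∈s = A++R⊆s (∈-++⁺ʳ A y∈R)

    increasing-listing : (s : Subset n) → Σ (List (Fin n)) λ xs →
      Increasing rank₀ xs × (∀ {y} → y ∈ xs → y ∈ₛ s) × ∣ s ∣ ≤ length xs
    increasing-listing s = xs , xs↑ , proj₂ ∘ ∈-filter⁻ (_∈ₛ? s) {xs = order} ,
      ≤-trans (p⊆q⇒∣p∣≤∣q∣ (λ y∈s → ∈-fromList⁺ (∈-filter⁺ (_∈ₛ? s) (order-complete _) y∈s)))
              (≤-reflexive (∣fromList∣≡length (Increasing⇒Unique rank₀ xs↑)))
      where
      xs : List (Fin n)
      xs = filter (_∈ₛ? s) order
      xs↑ : Increasing rank₀ xs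
      xs↑ = AllPairs.filter⁺ (_∈ₛ? s) order↑

    -- the K + 1 leftmost points of s supply u and x, the t rightmost the remaining points
    tuple-of-colour : (s : Subset n) → suc (K + t) ≤ ∣ s ∣ → (c : Fin (suc k)) → TupleOfColour s c
    tuple-of-colour s s-large c with increasing-listing s
    ... | xs , xs↑ , xs⊆s , ∣s∣≤∣xs∣ with splitFromEnd t xs (≤-trans (m≤n+m t (suc K)) (≤-trans s-large ∣s∣≤∣xs∣))
    ... | A , R , refl , ∣A∣≡ , ∣R∣≡t with AllPairs-++⁻ A xs↑
    ... | A↑ , R↑ , A<R = tuple-from-point (point-of-colour A↑ A-large c) A<R R↑ ∣R∣≡t xs⊆s
      where
      A-large : K < length A
      A-large = subst (K <_) (sym ∣A∣≡) (m+n≤o⇒m≤o∸n (suc K) (≤-trans s-large ∣s∣≤∣xs∣))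

m+[2+n]∸1≡1+m+n : ∀ m n → m + suc (suc n) ∸ 1 ≡ suc (m + n)
m+[2+n]∸1≡1+m+n m n = trans (cong (_∸ 1) (+-suc m (suc n))) (+-suc m n)

module BoxColouring (O : TotalOrder 0ℓ 0ℓ 0ℓ) (d : ℕ) {n : ℕ} (pts : Fin n → Geometry.Point O (suc d)) where
  open TotalOrder O using (total) renaming (_≤_ to _≤ₒ_; refl to ≤ₒ-refl; trans to ≤ₒ-trans)
  open Geometry O (suc d)

  inHalfspace-between : ∀ h {p q r} → inHalfspace h p → inHalfspace h r →
    (∀ i → Between _≤ₒ_ (p i) (q i) (r i)) → inHalfspace h q
  inHalfspace-between (halfspace i true β) p≤β r≤β pqr with pqr i
  ... | inj₁ (_ , q≤r) = ≤ₒ-trans q≤r r≤β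
  ... | inj₂ (_ , q≤p) = ≤ₒ-trans q≤p p≤β
  inHalfspace-between (halfspace i false β) β≤p β≤r pqr with pqr i
  ... | inj₁ (p≤q , _) = ≤ₒ-trans β≤p p≤q
  ... | inj₂ (r≤q , _) = ≤ₒ-trans β≤r r≤q

  inBox-between : ∀ B {p q r} → inBox B p → inBox B r → (∀ i → Between _≤ₒ_ (p i) (q i) (r i)) → inBox B q
  inBox-between B p∈B r∈B pqr = All.zipWith (λ {h} (p∈h , r∈h) → inHalfspace-between h p∈h r∈h pqr) (p∈B , r∈B)

  module ByCoordinate (i : Fin (suc d)) = InsertionSort (λ a c → total (pts a i) (pts c i)) ≤ₒ-trans
  open Position (Fin._≟_ {n})

  sorted : Fin (suc d) → List (Fin n)
  sorted i = ByCoordinate.sort i (allFin n)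

  sorted-↭ : ∀ i → allFin n ↭ sorted i
  sorted-↭ i = ↭-sym (ByCoordinate.sort-↭ i (allFin n))

  sorted-complete : ∀ i a → a ∈ sorted i
  sorted-complete i a = ∈-resp-↭ (sorted-↭ i) (∈-allFin a)

  rank : Fin (suc d) → Fin n → ℕ
  rank i = position (sorted i)

  rank-injective : ∀ i {a c} → rank i a ≡ rank i c → a ≡ c
  rank-injective i = position-injective (sorted i) (sorted-complete i _) (sorted-complete i _)

  rank-monotone : ∀ i {a c} → rank i a ≤ rank i c → pts a i ≤ₒ pts c i
  rank-monotone i {a} {c} ra≤rc with m≤n⇒m<n∨m≡n ra≤rc
  ... | inj₁ ra<rc = position-<⇒related (ByCoordinate.sort-sorted i (allFin n))
                       (sorted-complete i a) (sorted-complete i c) ra<rc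
  ... | inj₂ ra≡rc = subst (λ z → pts a i ≤ₒ pts z i) (rank-injective i ra≡rc) ≤ₒ-refl

  open Ranked rank rank-injective (length (sorted Fin.zero)) (λ a → position-< (sorted Fin.zero) (sorted-complete Fin.zero a))

  RankBetween⇒Between : ∀ {a y b} → RankBetween a y b → ∀ i → Between _≤ₒ_ (pts a i) (pts y i) (pts b i)
  RankBetween⇒Between ayb i = Sum.map (Product.map (rank-monotone i) (rank-monotone i))
    (Product.map (rank-monotone i) (rank-monotone i)) (ayb i)

  module _ (k t : ℕ) where
    open Colouring (sorted Fin.zero) (sorted-complete Fin.zero)
      (position-increasing (Unique-resp-↭ (setoid (Fin n)) (↭⇒↭ₛ (sorted-↭ Fin.zero)) (allFin⁺ n))) k t

    tuple-in-box : ∀ B {s c} → SubsetInBox pts B s → TupleOfColour s c →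
      ContainsTupleOfColour pts (suc (suc t)) colour B c
    tuple-in-box B s⊆B (T , ∣T∣≡ , T-hull , T-colour) = T , ∣T∣≡ , T⊆B , T-colour
      where
      T⊆B : SubsetInBox pts B T
      T⊆B y y∈T with T-hull y y∈T
      ... | a , b , a∈s , b∈s , ayb = inBox-between B (s⊆B a a∈s) (s⊆B b b∈s) (RankBetween⇒Between ayb)

    colouring : Σ (Subset n → Fin (suc k)) λ c → (B : Box) →
      ContainsAtLeast pts B (suc k ^ 2 ^ d + suc (suc t) ∸ 1) →
      (j : Fin (suc k)) → ContainsTupleOfColour pts (suc (suc t)) c B j
    colouring = colour , λ B (s , s-large , s⊆B) j →
      tuple-in-box B s⊆B (tuple-of-colour s (subst (_≤ ∣ s ∣) (m+[2+n]∸1≡1+m+n K t) s-large) j)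

theorem8 : (t d k : ℕ) → 2 ≤ t → 1 ≤ d → 1 ≤ k →
    Σ ℕ λ m → (m ≤ (k ^ (2 ^ (d ∸ 1))) + t ∸ 1) ×
      ((O : TotalOrder 0ℓ 0ℓ 0ℓ) → (n : ℕ) → (S : Geometry.PointSet O d n) →
        Σ (Subset n → Fin k) λ c →
          (B : Geometry.Box O d) →
          Geometry.ContainsAtLeast O d (proj₁ S) B m →
          (j : Fin k) → Geometry.ContainsTupleOfColour O d (proj₁ S) t c B j)
theorem8 (suc (suc t)) (suc d) (suc k) (s≤s (s≤s z≤n)) (s≤s z≤n) (s≤s z≤n) =
  suc k ^ 2 ^ d + suc (suc t) ∸ 1 , ≤-refl , λ O n S → BoxColouring.colouring O d (proj₁ S) k t
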